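{- Let $\mathsf{u}\in\mathcal{A}$ and let $\mathsf{u}^*,\mathsf{v}^*$ be equitable partitions of $\mathsf{u}$. Then the partitioned words $\mathsf{u}^*\vee\mathsf{v}^*$ and $\mathsf{u}^*\wedge\mathsf{v}^*$ of $\mathsf{u}$, defined by $\mathsf{block}(\mathsf{u}^*\vee\mathsf{v}^*,i)=\min\{\mathsf{block}(\mathsf{u}^*,i),\mathsf{block}(\mathsf{v}^*,i)\}$ and $\mathsf{block}(\mathsf{u}^*\wedge\mathsf{v}^*,i)=\max\{\mathsf{block}(\mathsf{u}^*,i),\mathsf{block}(\mathsf{v}^*,i)\}$ for $1\le i\le N$, are both equitable partitions.
   Context: Fix positive integers $m,N$. Let $\mathcal{A}$ be the set of words $\mathsf{u}=\mathsf{u}_1\cdots\mathsf{u}_N$ of length $N$ over $\{0,1,\ldots,m-1\}$; write $|\mathsf{u}|=\sum_i\mathsf{u}_i$ and $|\mathsf{u}|_m=|\mathsf{u}|\bmod m$. A partitioned word of $\mathsf{u}$ is a decomposition $\mathsf{u}^*=\mathsf{u}^*_{m-1}|\cdots|\mathsf{u}^*_0$ of $\mathsf{u}$ into $m$ possibly empty consecutive factors (blocks) whose concatenation is $\mathsf{u}$; $\mathsf{block}(\mathsf{u}^*,i)=k$ if $\mathsf{u}_i$ lies in $\mathsf{u}^*_k$. A partitioned word is thus determined by the weakly decreasing function $i\mapsto\mathsf{block}(\mathsf{u}^*,i)$ from $\{1,\ldots,N\}$ to $\{0,\ldots,m-1\}$, and every such function arises. The balancing array of $\mathsf{u}^*$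 is the $N\times m$ array (rows $i=1..N$, columns $j=m-1,\ldots,0$) whose entry $(i,j)$ is filled iff $j\equiv\mathsf{block}(\mathsf{u}^*,i)-t\pmod m$ for some $0\le t\le\mathsf{u}_i-1$. Column $j$ is equitably filled if it has exactly $\lfloor|\mathsf{u}|/m\rfloor+1$ filled entries when $1\le j\le|\mathsf{u}|_m$ and exactly $\lfloor|\mathsf{u}|/m\rfloor$ when $j=0$ or $j>|\mathsf{u}|_m$; $\mathsf{u}^*$ is an equitable partition if all columns are equitably filled. -}

module Defs where

open import Data.Nat as ℕ using (ℕ; zero; suc; _<_; _≤_; NonZero)
open import Data.Nat.DivMod using (_/_; _%_)
open import Data.Fin as Fin using (Fin; toℕ)
open import Data.Fin.Properties using (any?)
open import Data.Integer as ℤ using (ℤ; +_)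
open import Data.Integer.Divisibility as ℤDiv using ()
open import Data.Nat.Divisibility using (_∣?_)
open import Data.List using (List; length; filter; allFin)
open import Data.Product using (∃; _×_)
open import Relation.Nullary using (Dec)
open import Data.Sum using (_⊎_)
open import Data.Bool using (if_then_else_)
open import Relation.Binary.PropositionalEquality using (_≡_)

-- A word of length N over {0,…,m-1}; positions are Fin N (position i ↔ index i+1).
Word : ℕ → ℕ → Set
Word m N = Fin N → Fin m

weight : ∀ {m N} → Word m N → ℕ
weight {N = zero}  u = 0
weight {N = suc N} u = toℕ (u Fin.zero) ℕ.+ weight (λ i → u (Fin.suc i))

-- A partitioned word of u is determined by its block function
-- i ↦ block(u*, i), which must be weakly decreasing; every such function arises.
BlockFun : ℕ → ℕ → Set
BlockFun m N = Fin N → Fin m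

WeaklyDecreasing : ∀ {m N} → BlockFun m N → Set
WeaklyDecreasing b = ∀ i j → i Fin.≤ j → b j Fin.≤ b i

-- Entry (i, j) of the balancing array is filled iff
-- j ≡ block(u*,i) - t (mod m) for some 0 ≤ t ≤ u_i - 1.
_≡_[mod_] : ℤ → ℤ → ℕ → Set
a ≡ b [mod m ] = (+ m) ℤDiv.∣ (a ℤ.- b)

_≡?_[mod_] : ∀ a b m → Dec (a ≡ b [mod m ])
a ≡? b [mod m ] = m ∣? ℤ.∣ a ℤ.- b ∣

Filled : ∀ {m N} → Word m N → BlockFun m N → Fin N → Fin m → Set
Filled {m} u b i j =
  ∃ λ (t : Fin (toℕ (u i))) → (+ toℕ j) ≡ (+ toℕ (b i)) ℤ.- (+ toℕ t) [mod m ]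

filled? : ∀ {m N} (u : Word m N) (b : BlockFun m N) i j → Dec (Filled {m} u b i j)
filled? {m} u b i j = any? (λ t → (+ toℕ j) ≡? (+ toℕ (b i)) ℤ.- (+ toℕ t) [mod m ])

columnCount : ∀ {m N} → Word m N → BlockFun m N → Fin m → ℕ
columnCount u b j = length (filter (λ i → filled? u b i j) (allFin _))

EquitablyFilled : ∀ {m N} .{{_ : NonZero m}} → Word m N → BlockFun m N → Fin m → Set
EquitablyFilled {m} u b j =
    (1 ≤ toℕ j × toℕ j ≤ weight u % m → columnCount u b j ≡ suc (weight u / m))
  × ((toℕ j ≡ 0 ⊎ weight u % m < toℕ j) → columnCount u b j ≡ weight u / m)

IsEquitablePartition : ∀ {m N} .{{_ : NonZero m}} → Word m N → BlockFun m N → Set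
IsEquitablePartition u b = WeaklyDecreasing b × (∀ j → EquitablyFilled u b j)

minF : ∀ {m} → Fin m → Fin m → Fin m
minF x y = if toℕ x ℕ.≤ᵇ toℕ y then x else y

maxF : ∀ {m} → Fin m → Fin m → Fin m
maxF x y = if toℕ x ℕ.≤ᵇ toℕ y then y else x

_∨ᵇ_ : ∀ {m N} → BlockFun m N → BlockFun m N → BlockFun m N
(b ∨ᵇ c) i = minF (b i) (c i)

_∧ᵇ_ : ∀ {m N} → BlockFun m N → BlockFun m N → BlockFun m N
(b ∧ᵇ c) i = maxF (b i) (c i)

module Submission where

-- Write x -ₘ j for the residue of x − j mod m.  Row i of the balancing array fills column j
-- exactly when block(u*, i) -ₘ j < uᵢ.  Since j ↦ x -ₘ j permutes the columns, every row has
-- exactly uᵢ filled entries, so the column counts of any partitioned word of u sum to |u|.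
-- Lowering blocks never empties an entry of column j as long as no block drops below j.
-- As u* and v* are weakly decreasing, for each j the rows with block ≥ j in u* and in v* are
-- nested initial segments; hence column j of u* ∨ v* has at least as many entries as column j
-- of u* or of v*, which agree by equitability.  Comparing totals, all these inequalities are
-- equalities; dually for u* ∧ v*.

open import Defs
open import Data.Nat using (ℕ; NonZero)
open import Data.Product using (_×_)

open import Algebra.Properties.CommutativeMonoid.Sum using ()
open import Data.Bool.Base using (true; false; T; if_then_else_)
open import Data.Fin.Base as Fin using (Fin; toℕ; fromℕ<)
open import Data.Fin.Permutation using (Permutation′; permutation)
open import Data.Fin.Properties using (toℕ<n; toℕ-fromℕ<; toℕ-injective; any?)
import Data.Integer as ℤ
open import Data.Integer using (+_)
import Data.Integer.Properties as ℤₚ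
open import Data.Integer.Divisibility.Signed using (∣ᵤ⇒∣; ∣⇒∣ᵤ; ∣m∣n⇒∣m-n)
open import Data.Integer.Tactic.RingSolver using (solve-∀)
open import Data.List.Base using (length; filter; tabulate)
open import Data.Nat.Base using (zero; suc; _+_; _∸_; _⊓_; _⊔_; _≤_; _<_; _≤ᵇ_; z≤n)
open import Data.Nat.DivMod using (_%_; _mod_; [m+n]%n≡m%n; m<n⇒m%n≡m)
open import Data.Nat.Divisibility using (_∣_; _∣0; ∣-refl; n∣m⇒m%n≡0)
open import Data.Nat.Properties
open import Data.Product using (_,_; proj₁; proj₂)
open import Data.Sum using (_⊎_; inj₁; inj₂)
open import Data.Unit using (tt)
open import Function.Bundles using (_⇔_; mk⇔; Equivalence)
open import Relation.Nullary using (Dec; yes; no; does; contradiction)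
open import Relation.Nullary.Decidable using (_×-dec_)
open import Relation.Unary using (Pred; Decidable)
open import Relation.Binary.PropositionalEquality

open Algebra.Properties.CommutativeMonoid.Sum +-0-commutativeMonoid
  using (sum-syntax; sum-cong-≗; sum-replicate-zero; ∑-comm; ∑-permute)
open Equivalence using (to; from)

indicator : ∀ {p} {P : Set p} → Dec P → ℕ
indicator P? = if does P? then 1 else 0

indicator-mono : ∀ {p q} {P : Set p} {Q : Set q} → (P → Q) →
  (P? : Dec P) (Q? : Dec Q) → indicator P? ≤ indicator Q?
indicator-mono f (yes p) (yes _) = ≤-refl
indicator-mono f (yes p) (no ¬q) = contradiction (f p) ¬q
indicator-mono f (no _)  _       = z≤n

indicator-cong : ∀ {p q} {P : Set p} {Q : Set q} → P ⇔ Q →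
  (P? : Dec P) (Q? : Dec Q) → indicator P? ≡ indicator Q?
indicator-cong P⇔Q P? Q? =
  ≤-antisym (indicator-mono (to P⇔Q) P? Q?) (indicator-mono (from P⇔Q) Q? P?)

length-filter-tabulate : ∀ {a p} {A : Set a} {P : Pred A p} (P? : Decidable P) {n}
  (f : Fin n → A) → length (filter P? (tabulate f)) ≡ ∑[ i < n ] indicator (P? (f i))
length-filter-tabulate P? {zero}  f = refl
length-filter-tabulate P? {suc n} f with P? (f Fin.zero)
... | yes _ = cong suc (length-filter-tabulate P? (λ i → f (Fin.suc i)))
... | no  _ = length-filter-tabulate P? (λ i → f (Fin.suc i))

∑-mono-≤ : ∀ {n} {f g : Fin n → ℕ} → (∀ i → f i ≤ g i) →
  ∑[ i < n ] f i ≤ ∑[ i < n ] g i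
∑-mono-≤ {zero}  f≤g = z≤n
∑-mono-≤ {suc n} f≤g = +-mono-≤ (f≤g Fin.zero) (∑-mono-≤ (λ i → f≤g (Fin.suc i)))

+-mono-≤-≡⇒≡ˡ : ∀ {a b c d} → a ≤ c → b ≤ d → a + b ≡ c + d → a ≡ c
+-mono-≤-≡⇒≡ˡ {a} {b} {c} {d} a≤c b≤d eq =
  ≤-antisym a≤c (+-cancelʳ-≤ d c a (≤-trans (≤-reflexive (sym eq)) (+-monoʳ-≤ a b≤d)))

∑-mono-≤-≡⇒≗ : ∀ {n} {f g : Fin n → ℕ} → (∀ i → f i ≤ g i) →
  ∑[ i < n ] f i ≡ ∑[ i < n ] g i → ∀ i → f i ≡ g i
∑-mono-≤-≡⇒≗ {suc n} {f} {g} f≤g eq = λ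
  { Fin.zero    → head-eq
  ; (Fin.suc i) → ∑-mono-≤-≡⇒≗ (λ i → f≤g (Fin.suc i))
                    (+-cancelˡ-≡ (f Fin.zero) _ _ (trans eq (cong (_+ _) (sym head-eq)))) i
  }
  where
  head-eq : f Fin.zero ≡ g Fin.zero
  head-eq = +-mono-≤-≡⇒≡ˡ (f≤g Fin.zero) (∑-mono-≤ (λ i → f≤g (Fin.suc i))) eq

-- Defining indicator through does makes suc k <? suc U and k <? U give the same summand.
∑-indicator-< : ∀ n U → ∑[ k < n ] indicator (toℕ k <? U) ≡ n ⊓ U
∑-indicator-< zero    U       = refl
∑-indicator-< (suc n) zero    = sum-replicate-zero n
∑-indicator-< (suc n) (suc U) = cong suc (∑-indicator-< n U)

weight≡∑ : ∀ {m N} (u : Word m N) → weight u ≡ ∑[ i < N ] toℕ (u i)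
weight≡∑ {N = zero}  u = refl
weight≡∑ {N = suc N} u = cong (λ w → toℕ (u Fin.zero) + w) (weight≡∑ (λ i → u (Fin.suc i)))

m∣n∧n<m⇒n≡0 : ∀ {m n} .{{_ : NonZero m}} → m ∣ n → n < m → n ≡ 0
m∣n∧n<m⇒n≡0 {m} {n} m∣n n<m = trans (sym (m<n⇒m%n≡m n<m)) (n∣m⇒m%n≡0 n m m∣n)

≡[mod]-below⇒≡ : ∀ {m a b} .{{_ : NonZero m}} → a < m → b < m →
  (+ a) ≡ (+ b) [mod m ] → a ≡ b
≡[mod]-below⇒≡ {m} {a} {b} a<m b<m a≡b =
  ℤₚ.+-injective (ℤₚ.i-j≡0⇒i≡j (+ a) (+ b) (ℤₚ.∣i∣≡0⇒i≡0 (m∣n∧n<m⇒n≡0 a≡b ∣a-b∣<m)))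
  where
  ∣a-b∣<m : ℤ.∣ + a ℤ.- + b ∣ < m
  ∣a-b∣<m = begin-strict
    ℤ.∣ + a ℤ.- + b ∣  ≡⟨ cong ℤ.∣_∣ (ℤₚ.[+m]-[+n]≡m⊖n a b) ⟩
    ℤ.∣ a ℤ.⊖ b ∣      ≤⟨ ℤₚ.∣m⊝n∣≤m⊔n a b ⟩
    a ⊔ b              <⟨ ⊔-lub a<m b<m ⟩
    m                  ∎
    where open ≤-Reasoning

a+c≡b⊎b+m⇒a≡b-c[mod] : ∀ {m} a b c → a + c ≡ b ⊎ a + c ≡ b + m →
  (+ a) ≡ (+ b) ℤ.- (+ c) [mod m ]
a+c≡b⊎b+m⇒a≡b-c[mod] {m} a b c a+c≡b⊎b+m =
  subst (λ z → m ∣ ℤ.∣ z ∣) (sym (shift a b c)) (divides a+c≡b⊎b+m)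
  where
  shift : ∀ a b c → (+ a) ℤ.- ((+ b) ℤ.- (+ c)) ≡ + (a + c) ℤ.- + b
  shift a b c = trans (ring (+ a) (+ b) (+ c)) (cong (ℤ._- + b) (sym (ℤₚ.pos-+ a c)))
    where
    ring : ∀ a b c → a ℤ.- (b ℤ.- c) ≡ (a ℤ.+ c) ℤ.- b
    ring = solve-∀
  add-sub : ∀ a b → + (a + b) ℤ.- + a ≡ + b
  add-sub a b = trans (cong (ℤ._- + a) (ℤₚ.pos-+ a b)) (ring (+ a) (+ b))
    where
    ring : ∀ a b → (a ℤ.+ b) ℤ.- a ≡ b
    ring = solve-∀
  divides : ∀ {s} → s ≡ b ⊎ s ≡ b + m → m ∣ ℤ.∣ + s ℤ.- + b ∣
  divides (inj₁ refl) = subst (λ z → m ∣ ℤ.∣ z ∣) (sym (ℤₚ.+-inverseʳ (+ b))) (m ∣0)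
  divides (inj₂ refl) = subst (λ z → m ∣ ℤ.∣ z ∣) (sym (add-sub b m)) ∣-refl

≡[mod]-sub-cancel : ∀ {m} a b c d →
  a ≡ b ℤ.- c [mod m ] → a ≡ b ℤ.- d [mod m ] → c ≡ d [mod m ]
≡[mod]-sub-cancel {m} a b c d a≡b-c a≡b-d = subst (λ z → m ∣ ℤ.∣ z ∣) (ring a b c d)
  (∣⇒∣ᵤ (∣m∣n⇒∣m-n (∣ᵤ⇒∣ {+ m} {a ℤ.- (b ℤ.- c)} a≡b-c) (∣ᵤ⇒∣ {+ m} {a ℤ.- (b ℤ.- d)} a≡b-d)))
  where
  ring : ∀ a b c d → (a ℤ.- (b ℤ.- c)) ℤ.- (a ℤ.- (b ℤ.- d)) ≡ c ℤ.- d
  ring = solve-∀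

module _ {m : ℕ} .{{_ : NonZero m}} where

  infixl 6 _-ₘ_

  _-ₘ_ : Fin m → Fin m → Fin m
  x -ₘ j = (toℕ x + m ∸ toℕ j) mod m

  toℕ-x-ₘj≡x∸j : ∀ {x j} → toℕ j ≤ toℕ x → toℕ (x -ₘ j) ≡ toℕ x ∸ toℕ j
  toℕ-x-ₘj≡x∸j {x} {j} j≤x = begin
    toℕ (x -ₘ j)               ≡⟨ toℕ-fromℕ< _ ⟩
    (toℕ x + m ∸ toℕ j) % m    ≡⟨ cong (_% m) (+-∸-comm m j≤x) ⟩
    (toℕ x ∸ toℕ j + m) % m    ≡⟨ [m+n]%n≡m%n (toℕ x ∸ toℕ j) m ⟩
    (toℕ x ∸ toℕ j) % m        ≡⟨ m<n⇒m%n≡m (≤-<-trans (m∸n≤m (toℕ x) (toℕ j)) (toℕ<n x)) ⟩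
    toℕ x ∸ toℕ j              ∎
    where open ≡-Reasoning

  toℕ-x-ₘj≡x+m∸j : ∀ {x j} → toℕ x < toℕ j → toℕ (x -ₘ j) ≡ toℕ x + m ∸ toℕ j
  toℕ-x-ₘj≡x+m∸j {x} {j} x<j = trans (toℕ-fromℕ< _)
    (m<n⇒m%n≡m (m<n+o⇒m∸n<o (toℕ x + m) (toℕ j) (+-monoˡ-< m x<j)))

  x-ₘj≤x : ∀ {x j} → toℕ j ≤ toℕ x → toℕ (x -ₘ j) ≤ toℕ x
  x-ₘj≤x {x} {j} j≤x = ≤-trans (≤-reflexive (toℕ-x-ₘj≡x∸j j≤x)) (m∸n≤m (toℕ x) (toℕ j))

  x<x-ₘj : ∀ {x j} → toℕ x < toℕ j → toℕ x < toℕ (x -ₘ j)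
  x<x-ₘj {x} {j} x<j = begin-strict
    toℕ x                    ≡⟨ m+n∸n≡m (toℕ x) (toℕ j) ⟨
    toℕ x + toℕ j ∸ toℕ j    <⟨ ∸-monoˡ-< (+-monoʳ-< (toℕ x) (toℕ<n j)) (m≤n+m (toℕ j) (toℕ x)) ⟩
    toℕ x + m ∸ toℕ j        ≡⟨ toℕ-x-ₘj≡x+m∸j x<j ⟨
    toℕ (x -ₘ j)             ∎
    where open ≤-Reasoning

  -ₘ-involutive : ∀ x j → x -ₘ (x -ₘ j) ≡ j
  -ₘ-involutive x j = toℕ-injective (involutive (toℕ j ≤? toℕ x))
    where
    involutive : Dec (toℕ j ≤ toℕ x) → toℕ (x -ₘ (x -ₘ j)) ≡ toℕ j
    involutive (yes j≤x) = begin
      toℕ (x -ₘ (x -ₘ j))      ≡⟨ toℕ-x-ₘj≡x∸j (x-ₘj≤x j≤x) ⟩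
      toℕ x ∸ toℕ (x -ₘ j)     ≡⟨ cong (toℕ x ∸_) (toℕ-x-ₘj≡x∸j j≤x) ⟩
      toℕ x ∸ (toℕ x ∸ toℕ j)  ≡⟨ m∸[m∸n]≡n j≤x ⟩
      toℕ j                    ∎
      where open ≡-Reasoning
    involutive (no j≰x) = begin
      toℕ (x -ₘ (x -ₘ j))              ≡⟨ toℕ-x-ₘj≡x+m∸j (x<x-ₘj (≰⇒> j≰x)) ⟩
      toℕ x + m ∸ toℕ (x -ₘ j)         ≡⟨ cong (toℕ x + m ∸_) (toℕ-x-ₘj≡x+m∸j (≰⇒> j≰x)) ⟩
      toℕ x + m ∸ (toℕ x + m ∸ toℕ j)  ≡⟨ m∸[m∸n]≡n (≤-trans (<⇒≤ (toℕ<n j)) (m≤n+m m (toℕ x))) ⟩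
      toℕ j                            ∎
      where open ≡-Reasoning

  reflection : Fin m → Permutation′ m
  reflection x = permutation (x -ₘ_) (x -ₘ_) (-ₘ-involutive x) (-ₘ-involutive x)

  -ₘ-monoˡ-≤ : ∀ {x y j} → toℕ y ≤ toℕ x → (toℕ j ≤ toℕ x → toℕ j ≤ toℕ y) →
    toℕ (y -ₘ j) ≤ toℕ (x -ₘ j)
  -ₘ-monoˡ-≤ {x} {y} {j} y≤x keeps-j with toℕ j ≤? toℕ x
  ... | yes j≤x = begin
    toℕ (y -ₘ j)       ≡⟨ toℕ-x-ₘj≡x∸j (keeps-j j≤x) ⟩
    toℕ y ∸ toℕ j      ≤⟨ ∸-monoˡ-≤ (toℕ j) y≤x ⟩
    toℕ x ∸ toℕ j      ≡⟨ toℕ-x-ₘj≡x∸j j≤x ⟨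
    toℕ (x -ₘ j)       ∎
    where open ≤-Reasoning
  ... | no j≰x = begin
    toℕ (y -ₘ j)       ≡⟨ toℕ-x-ₘj≡x+m∸j (≤-<-trans y≤x (≰⇒> j≰x)) ⟩
    toℕ y + m ∸ toℕ j  ≤⟨ ∸-monoˡ-≤ (toℕ j) (+-monoˡ-≤ m y≤x) ⟩
    toℕ x + m ∸ toℕ j  ≡⟨ toℕ-x-ₘj≡x+m∸j (≰⇒> j≰x) ⟨
    toℕ (x -ₘ j)       ∎
    where open ≤-Reasoning

  j+[x-ₘj]≡x⊎x+m : ∀ x j → toℕ j + toℕ (x -ₘ j) ≡ toℕ x ⊎ toℕ j + toℕ (x -ₘ j) ≡ toℕ x + m
  j+[x-ₘj]≡x⊎x+m x j with toℕ j ≤? toℕ x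
  ... | yes j≤x = inj₁ (trans (cong (_+_ (toℕ j)) (toℕ-x-ₘj≡x∸j j≤x)) (m+[n∸m]≡n j≤x))
  ... | no  j≰x = inj₂ (trans (cong (_+_ (toℕ j)) (toℕ-x-ₘj≡x+m∸j (≰⇒> j≰x)))
                              (m+[n∸m]≡n (≤-trans (<⇒≤ (toℕ<n j)) (m≤n+m m (toℕ x)))))

  j≡x-[x-ₘj][mod] : ∀ x j → (+ toℕ j) ≡ (+ toℕ x) ℤ.- (+ toℕ (x -ₘ j)) [mod m ]
  j≡x-[x-ₘj][mod] x j =
    a+c≡b⊎b+m⇒a≡b-c[mod] (toℕ j) (toℕ x) (toℕ (x -ₘ j)) (j+[x-ₘj]≡x⊎x+m x j)

  j≡x-t[mod]⇔t≡x-ₘj : ∀ x j t → t < m →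
    (+ toℕ j) ≡ (+ toℕ x) ℤ.- (+ t) [mod m ] ⇔ t ≡ toℕ (x -ₘ j)
  j≡x-t[mod]⇔t≡x-ₘj x j t t<m = mk⇔
    (λ j≡x-t → ≡[mod]-below⇒≡ t<m (toℕ<n (x -ₘ j))
      (≡[mod]-sub-cancel (+ toℕ j) (+ toℕ x) (+ t) (+ toℕ (x -ₘ j)) j≡x-t (j≡x-[x-ₘj][mod] x j)))
    (λ { refl → j≡x-[x-ₘj][mod] x j })

toℕ-minF : ∀ {m} (x y : Fin m) → toℕ (minF x y) ≡ toℕ x ⊓ toℕ y
toℕ-minF x y with toℕ x ≤ᵇ toℕ y in x≤ᵇy
... | true  = sym (m≤n⇒m⊓n≡m (≤ᵇ⇒≤ (toℕ x) (toℕ y) (subst T (sym x≤ᵇy) tt)))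
... | false = sym (m≥n⇒m⊓n≡n (≰⇒≥ (λ x≤y → subst T x≤ᵇy (≤⇒≤ᵇ x≤y))))

toℕ-maxF : ∀ {m} (x y : Fin m) → toℕ (maxF x y) ≡ toℕ x ⊔ toℕ y
toℕ-maxF x y with toℕ x ≤ᵇ toℕ y in x≤ᵇy
... | true  = sym (m≤n⇒m⊔n≡n (≤ᵇ⇒≤ (toℕ x) (toℕ y) (subst T (sym x≤ᵇy) tt)))
... | false = sym (m≥n⇒m⊔n≡m (≰⇒≥ (λ x≤y → subst T x≤ᵇy (≤⇒≤ᵇ x≤y))))

∨ᵇ-weaklyDecreasing : ∀ {m N} {b c : BlockFun m N} →
  WeaklyDecreasing b → WeaklyDecreasing c → WeaklyDecreasing (b ∨ᵇ c)
∨ᵇ-weaklyDecreasing {b = b} {c} b-dec c-dec i j i≤j =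
  subst₂ _≤_ (sym (toℕ-minF (b j) (c j))) (sym (toℕ-minF (b i) (c i)))
    (⊓-mono-≤ (b-dec i j i≤j) (c-dec i j i≤j))

∧ᵇ-weaklyDecreasing : ∀ {m N} {b c : BlockFun m N} →
  WeaklyDecreasing b → WeaklyDecreasing c → WeaklyDecreasing (b ∧ᵇ c)
∧ᵇ-weaklyDecreasing {b = b} {c} b-dec c-dec i j i≤j =
  subst₂ _≤_ (sym (toℕ-maxF (b j) (c j))) (sym (toℕ-maxF (b i) (c i)))
    (⊔-mono-≤ (b-dec i j i≤j) (c-dec i j i≤j))

UpperLevelSet⊆ : ∀ {m N} → BlockFun m N → BlockFun m N → ℕ → Set
UpperLevelSet⊆ b c J = ∀ i → J ≤ toℕ (b i) → J ≤ toℕ (c i)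

upperLevelSets-nested : ∀ {m N} {b c : BlockFun m N} → WeaklyDecreasing b → WeaklyDecreasing c →
  ∀ J → UpperLevelSet⊆ b c J ⊎ UpperLevelSet⊆ c b J
upperLevelSets-nested {b = b} {c} b-dec c-dec J
  with any? (λ i → (J ≤? toℕ (b i)) ×-dec (toℕ (c i) <? J))
... | no ∄i = inj₁ (λ i J≤bᵢ → ≮⇒≥ (λ cᵢ<J → ∄i (i , J≤bᵢ , cᵢ<J)))
... | yes (k , J≤bₖ , cₖ<J) = inj₂ c⊆b
  where
  c⊆b : UpperLevelSet⊆ c b J
  c⊆b i J≤cᵢ with toℕ k ≤? toℕ i
  ... | yes k≤i = contradiction (≤-trans J≤cᵢ (c-dec k i k≤i)) (<⇒≱ cₖ<J)
  ... | no  k≰i = ≤-trans J≤bₖ (b-dec i k (<⇒≤ (≰⇒> k≰i)))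

module _ {m N : ℕ} .{{_ : NonZero m}} (u : Word m N) where

  filled⇔ : ∀ (z : BlockFun m N) i j → Filled u z i j ⇔ toℕ (z i -ₘ j) < toℕ (u i)
  filled⇔ z i j = mk⇔
    (λ { (t , j≡zᵢ-t) → subst (_< toℕ (u i))
           (to (j≡x-t[mod]⇔t≡x-ₘj (z i) j (toℕ t) (below-m t)) j≡zᵢ-t) (toℕ<n t) })
    (λ d<uᵢ → fromℕ< d<uᵢ ,
       from (j≡x-t[mod]⇔t≡x-ₘj (z i) j _ (below-m (fromℕ< d<uᵢ))) (toℕ-fromℕ< d<uᵢ))
    where
    below-m : (t : Fin (toℕ (u i))) → toℕ t < m
    below-m t = <-trans (toℕ<n t) (toℕ<n (u i))

  row-count : ∀ (z : BlockFun m N) i → ∑[ j < m ] indicator (filled? u z i j) ≡ toℕ (u i)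
  row-count z i = begin
    ∑[ j < m ] indicator (filled? u z i j)
      ≡⟨ sum-cong-≗ (λ j → indicator-cong (filled⇔ z i j) (filled? u z i j) (toℕ (z i -ₘ j) <? U)) ⟩
    ∑[ j < m ] indicator (toℕ (z i -ₘ j) <? U)
      ≡⟨ ∑-permute (λ k → indicator (toℕ k <? U)) (reflection (z i)) ⟨
    ∑[ k < m ] indicator (toℕ k <? U)
      ≡⟨ ∑-indicator-< m U ⟩
    m ⊓ U
      ≡⟨ m≥n⇒m⊓n≡n (<⇒≤ (toℕ<n (u i))) ⟩
    U ∎
    where
    open ≡-Reasoning
    U : ℕ
    U = toℕ (u i)

  columnCount≡∑ : ∀ (z : BlockFun m N) j →
    columnCount u z j ≡ ∑[ i < N ] indicator (filled? u z i j)
  columnCount≡∑ z j = length-filter-tabulate (λ i → filled? u z i j) (λ i → i)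

  ∑-columnCount : ∀ (z : BlockFun m N) → ∑[ j < m ] columnCount u z j ≡ weight u
  ∑-columnCount z = begin
    ∑[ j < m ] columnCount u z j        ≡⟨ sum-cong-≗ (columnCount≡∑ z) ⟩
    ∑[ j < m ] ∑[ i < N ] entry i j     ≡⟨ ∑-comm entry ⟨
    ∑[ i < N ] ∑[ j < m ] entry i j     ≡⟨ sum-cong-≗ (row-count z) ⟩
    ∑[ i < N ] toℕ (u i)                ≡⟨ weight≡∑ u ⟨
    weight u                            ∎
    where
    open ≡-Reasoning
    entry : Fin N → Fin m → ℕ
    entry i j = indicator (filled? u z i j)

  columnCount-lowering : ∀ {z z' : BlockFun m N} j → (∀ i → toℕ (z' i) ≤ toℕ (z i)) →
    (∀ i → toℕ j ≤ toℕ (z i) → toℕ j ≤ toℕ (z' i)) → columnCount u z j ≤ columnCount u z' j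
  columnCount-lowering {z} {z'} j z'≤z keeps-j = begin
    columnCount u z j                        ≡⟨ columnCount≡∑ z j ⟩
    ∑[ i < N ] indicator (filled? u z i j)   ≤⟨ ∑-mono-≤ (λ i → indicator-mono (stays-filled i)
                                                  (filled? u z i j) (filled? u z' i j)) ⟩
    ∑[ i < N ] indicator (filled? u z' i j)  ≡⟨ columnCount≡∑ z' j ⟨
    columnCount u z' j                       ∎
    where
    open ≤-Reasoning
    stays-filled : ∀ i → Filled u z i j → Filled u z' i j
    stays-filled i filled = from (filled⇔ z' i j)
      (≤-<-trans (-ₘ-monoˡ-≤ (z'≤z i) (keeps-j i)) (to (filled⇔ z i j) filled))

  columnCount-≤-meet : ∀ {x y z : BlockFun m N} j →
    (∀ i → toℕ (z i) ≡ toℕ (x i) ⊓ toℕ (y i)) →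
    UpperLevelSet⊆ x y (toℕ j) → columnCount u x j ≤ columnCount u z j
  columnCount-≤-meet {x} {y} {z} j z≡x⊓y x⊆y = columnCount-lowering j
    (λ i → subst (_≤ toℕ (x i)) (sym (z≡x⊓y i)) (m⊓n≤m (toℕ (x i)) (toℕ (y i))))
    (λ i j≤xᵢ → subst (toℕ j ≤_) (sym (z≡x⊓y i)) (⊓-glb j≤xᵢ (x⊆y i j≤xᵢ)))

  columnCount-join-≤ : ∀ {x y z : BlockFun m N} j →
    (∀ i → toℕ (z i) ≡ toℕ (x i) ⊔ toℕ (y i)) →
    UpperLevelSet⊆ x y (toℕ j) → columnCount u z j ≤ columnCount u y j
  columnCount-join-≤ {x} {y} {z} j z≡x⊔y x⊆y = columnCount-lowering j
    (λ i → subst (toℕ (y i) ≤_) (sym (z≡x⊔y i)) (m≤n⊔m (toℕ (x i)) (toℕ (y i))))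
    (λ i j≤zᵢ → j≤yᵢ i (subst (toℕ j ≤_) (z≡x⊔y i) j≤zᵢ))
    where
    j≤yᵢ : ∀ i → toℕ j ≤ toℕ (x i) ⊔ toℕ (y i) → toℕ j ≤ toℕ (y i)
    j≤yᵢ i j≤x⊔y with ⊔-sel (toℕ (x i)) (toℕ (y i))
    ... | inj₁ x⊔y≡x = x⊆y i (subst (toℕ j ≤_) x⊔y≡x j≤x⊔y)
    ... | inj₂ x⊔y≡y = subst (toℕ j ≤_) x⊔y≡y j≤x⊔y

  equitable-columnCount : ∀ {b c : BlockFun m N} →
    IsEquitablePartition u b → IsEquitablePartition u c →
    ∀ j → columnCount u b j ≡ columnCount u c j
  equitable-columnCount (_ , b-eq) (_ , c-eq) j with 1 ≤? toℕ j | toℕ j ≤? weight u % m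
  ... | yes 1≤j | yes j≤r = trans (proj₁ (b-eq j) (1≤j , j≤r)) (sym (proj₁ (c-eq j) (1≤j , j≤r)))
  ... | yes _   | no  j≰r =
    trans (proj₂ (b-eq j) (inj₂ (≰⇒> j≰r))) (sym (proj₂ (c-eq j) (inj₂ (≰⇒> j≰r))))
  ... | no  1≰j | _       =
    trans (proj₂ (b-eq j) (inj₁ j≡0)) (sym (proj₂ (c-eq j) (inj₁ j≡0)))
    where
    j≡0 : toℕ j ≡ 0
    j≡0 = n<1⇒n≡0 (≰⇒> 1≰j)

  equitable-by-columnCount : ∀ {b z : BlockFun m N} →
    IsEquitablePartition u b → WeaklyDecreasing z →
    (∀ j → columnCount u z j ≡ columnCount u b j) → IsEquitablePartition u z
  equitable-by-columnCount (_ , b-eq) z-dec same = z-dec , λ j →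
    (λ h → trans (same j) (proj₁ (b-eq j) h)) , (λ h → trans (same j) (proj₂ (b-eq j) h))

module _ {m N : ℕ} .{{_ : NonZero m}} (u : Word m N) {b c : BlockFun m N}
         (b-equitable : IsEquitablePartition u b) (c-equitable : IsEquitablePartition u c) where

  private
    b-dec : WeaklyDecreasing b
    b-dec = proj₁ b-equitable

    c-dec : WeaklyDecreasing c
    c-dec = proj₁ c-equitable

    b≗c : ∀ j → columnCount u b j ≡ columnCount u c j
    b≗c = equitable-columnCount u b-equitable c-equitable

  ∨ᵇ-equitable : IsEquitablePartition u (b ∨ᵇ c)
  ∨ᵇ-equitable = equitable-by-columnCount u b-equitable (∨ᵇ-weaklyDecreasing b-dec c-dec)
    (λ j → sym (∑-mono-≤-≡⇒≗ b≤b∨c (trans (∑-columnCount u b) (sym (∑-columnCount u (b ∨ᵇ c)))) j))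
    where
    b≤b∨c : ∀ j → columnCount u b j ≤ columnCount u (b ∨ᵇ c) j
    b≤b∨c j with upperLevelSets-nested b-dec c-dec (toℕ j)
    ... | inj₁ b⊆c = columnCount-≤-meet u j (λ i → toℕ-minF (b i) (c i)) b⊆c
    ... | inj₂ c⊆b = subst (_≤ columnCount u (b ∨ᵇ c) j) (sym (b≗c j))
      (columnCount-≤-meet u j (λ i → trans (toℕ-minF (b i) (c i)) (⊓-comm (toℕ (b i)) (toℕ (c i))))
        c⊆b)

  ∧ᵇ-equitable : IsEquitablePartition u (b ∧ᵇ c)
  ∧ᵇ-equitable = equitable-by-columnCount u b-equitable (∧ᵇ-weaklyDecreasing b-dec c-dec)
    (∑-mono-≤-≡⇒≗ b∧c≤b (trans (∑-columnCount u (b ∧ᵇ c)) (sym (∑-columnCount u b))))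
    where
    b∧c≤b : ∀ j → columnCount u (b ∧ᵇ c) j ≤ columnCount u b j
    b∧c≤b j with upperLevelSets-nested b-dec c-dec (toℕ j)
    ... | inj₁ b⊆c = subst (columnCount u (b ∧ᵇ c) j ≤_) (sym (b≗c j))
      (columnCount-join-≤ u j (λ i → toℕ-maxF (b i) (c i)) b⊆c)
    ... | inj₂ c⊆b =
      columnCount-join-≤ u j (λ i → trans (toℕ-maxF (b i) (c i)) (⊔-comm (toℕ (b i)) (toℕ (c i))))
        c⊆b

proposition5p7 : (m N : ℕ) .{{_ : NonZero m}} .{{_ : NonZero N}}
    → (u : Word m N) (b c : BlockFun m N)
    → IsEquitablePartition u b → IsEquitablePartition u c
    → IsEquitablePartition u (b ∨ᵇ c) × IsEquitablePartition u (b ∧ᵇ c)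
proposition5p7 m N u b c b-equitable c-equitable =
  ∨ᵇ-equitable u b-equitable c-equitable , ∧ᵇ-equitable u b-equitable c-equitable
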